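{- Let $\mathcal C$ and $\mathcal E$ be the type frames over the single ground type $\mathrm{bool}$ defined by: $\mathcal C_{\mathrm{bool}}=\{\bot,tt,ff\}$ ordered by $\bot<tt,ff$ and $\mathcal C_{\sigma\to\tau}$ the set of monotone functions $\mathcal C_\sigma\to\mathcal C_\tau$ (ordered pointwise); $\mathcal E_{\mathrm{bool}}=\{tt,ff,\top\}$ ordered by $tt,ff<\top$ and $\mathcal E_{\sigma\to\tau}$ the set of monotone functions $\mathcal E_\sigma\to\mathcal E_\tau$ (ordered pointwise). Let $\mathrm E$ be the logical relation between $\mathcal C$ and $\mathcal E$ with $\mathrm E_{\mathrm{bool}}=\{(tt,tt),(ff,ff),(\bot,\top)\}$, i.e. $\mathrm E_{\sigma\to\tau}=\{(f,g): \forall (x,y)\in\mathrm E_\sigma,\ (f(x),g(y))\in\mathrm E_\tau\}$. Then $\mathrm E$ is a pre-logical isomorphism: both $\mathrm E$ and its inverse $\mathrm E^{ -1}$ are pre-logical surjections.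
   Context: Simple types over $\{\mathrm{bool}\}$ are generated from $\mathrm{bool}$ by $\sigma\to\tau$. A type frame is a family of sets $(\mathcal M_\sigma)$ with $\mathcal M_{\sigma\to\tau}$ a set of functions $\mathcal M_\sigma\to\mathcal M_\tau$. Pure simply typed $\lambda$-terms (no constants) are interpreted with environments $\rho$: $[\![x]\!]_\rho=\rho(x)$, $[\![PQ]\!]_\rho=[\![P]\!]_\rho([\![Q]\!]_\rho)$, $[\![\lambda x.P]\!]_\rho=(d\mapsto[\![P]\!]_{\rho[x:=d]})$. A binary pre-logical relation between type frames $\mathcal M,\mathcal N$ is a family $\mathrm R_\sigma\subseteq\mathcal M_\sigma\times\mathcal N_\sigma$ such that (1) $(f,g)\in\mathrm R_{\sigma\to\tau}$ and $(x,y)\in\mathrm R_\sigma$ imply $(f(x),g(y))\in\mathrm R_\tau$, and (2) for every pure term $P{:}\tau$, variable $z{:}\sigma$ and environments $\rho,\rho'$ related pointwise by $\mathrm R$: if $([\![P]\!]^{\mathcal M}_{\rho[z:=a]},[\![P]\!]^{\mathcal N}_{\rho'[z:=b]})\in\mathrm R_\tau$ for all $(a,b)\in\mathrm R_\sigma$ then $([\![\lambda z.P]\!]^{\mathcal M}_\rho,[\![\lambda z.P]\!]^{\mathcal N}_{\rho'})\in\mathrm R_{\sigma\to\tau}$. A pre-logical surjection is a pre-logical relation that is, at every type, surjective onto the second frame and a partial function. -}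

module Defs where

open import Data.Product using (Σ; _×_; _,_; proj₁; proj₂)
open import Relation.Binary.PropositionalEquality using (_≡_)

infixr 5 _⇒_
data Ty : Set where
  bool : Ty
  _⇒_  : Ty → Ty → Ty

infixl 4 _▸_
data Ctx : Set where
  ∅   : Ctx
  _▸_ : Ctx → Ty → Ctx

data _∋_ : Ctx → Ty → Set where
  here  : ∀ {Γ σ} → (Γ ▸ σ) ∋ σ
  there : ∀ {Γ σ τ} → Γ ∋ σ → (Γ ▸ τ) ∋ σ

data Tm (Γ : Ctx) : Ty → Set where
  var : ∀ {σ} → Γ ∋ σ → Tm Γ σ
  app : ∀ {σ τ} → Tm Γ (σ ⇒ τ) → Tm Γ σ → Tm Γ τ
  lam : ∀ {σ τ} → Tm (Γ ▸ σ) τ → Tm Γ (σ ⇒ τ)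

Env : (Ty → Set) → Ctx → Set
Env A Γ = ∀ {σ} → Γ ∋ σ → A σ

_,,_ : ∀ {A : Ty → Set} {Γ σ} → Env A Γ → A σ → Env A (Γ ▸ σ)
(ρ ,, d) here      = d
(ρ ,, d) (there x) = ρ x

record Frame : Set₁ where
  field
    Car   : Ty → Set
    _≈_   : ∀ {σ} → Car σ → Car σ → Set
    apply : ∀ {σ τ} → Car (σ ⇒ τ) → Car σ → Car τ
    ⟦_⟧   : ∀ {Γ τ} → Tm Γ τ → Env Car Γ → Car τ

module MonotoneFrame (B : Set) (_⊑_ : B → B → Set)
                     (⊑-refl : ∀ x → x ⊑ x)
                     (⊑-trans : ∀ {x y z} → x ⊑ y → y ⊑ z → x ⊑ z) where

  mutual
    Car : Ty → Set
    Car bool    = B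
    Car (σ ⇒ τ) = Σ (Car σ → Car τ) (λ f → ∀ {x y} → _≤_ {σ} x y → _≤_ {τ} (f x) (f y))

    _≤_ : ∀ {σ} → Car σ → Car σ → Set
    _≤_ {bool}  x y = x ⊑ y
    _≤_ {σ ⇒ τ} f g = ∀ x → _≤_ {τ} (proj₁ f x) (proj₁ g x)

  _≈_ : ∀ {σ} → Car σ → Car σ → Set
  _≈_ {bool}  x y = x ≡ y
  _≈_ {σ ⇒ τ} f g = ∀ x → _≈_ {τ} (proj₁ f x) (proj₁ g x)

  ≤-refl : ∀ {σ} (x : Car σ) → _≤_ {σ} x x
  ≤-refl {bool}  x = ⊑-refl x
  ≤-refl {σ ⇒ τ} f = λ x → ≤-refl {τ} (proj₁ f x)

  ≤-trans : ∀ {σ} {x y z : Car σ} → _≤_ {σ} x y → _≤_ {σ} y z → _≤_ {σ} x z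
  ≤-trans {bool}  p q = ⊑-trans p q
  ≤-trans {σ ⇒ τ} p q = λ x → ≤-trans {τ} (p x) (q x)

  _≤E_ : ∀ {Γ} → Env Car Γ → Env Car Γ → Set
  _≤E_ {Γ} ρ ρ' = ∀ {σ} (x : Γ ∋ σ) → _≤_ {σ} (ρ x) (ρ' x)

  ext-≤ : ∀ {Γ σ} {ρ ρ' : Env Car Γ} {d d' : Car σ} →
          ρ ≤E ρ' → _≤_ {σ} d d' → _≤E_ {Γ ▸ σ} (ρ ,, d) (ρ' ,, d')
  ext-≤ r p here      = p
  ext-≤ r p (there x) = r x

  mutual
    ⟦_⟧ : ∀ {Γ τ} → Tm Γ τ → Env Car Γ → Car τ
    ⟦ var x ⟧   ρ = ρ x
    ⟦ app P Q ⟧ ρ = proj₁ (⟦ P ⟧ ρ) (⟦ Q ⟧ ρ)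
    ⟦ lam P ⟧   ρ = (λ d → ⟦ P ⟧ (ρ ,, d)) ,
                    (λ d≤d' → mono P (ext-≤ (λ x → ≤-refl (ρ x)) d≤d'))

    mono : ∀ {Γ τ} (P : Tm Γ τ) {ρ ρ' : Env Car Γ} → ρ ≤E ρ' →
           _≤_ {τ} (⟦ P ⟧ ρ) (⟦ P ⟧ ρ')
    mono (var x) r = r x
    mono (app {σ} {τ} P Q) {ρ} {ρ'} r =
      ≤-trans {τ} (proj₂ (⟦ P ⟧ ρ) (mono Q r)) (mono P r (⟦ Q ⟧ ρ'))
    mono (lam {σ} {τ} P) r = λ d → mono P (ext-≤ r (≤-refl {σ} d))

  frame : Frame
  frame = record { Car = Car ; _≈_ = λ {σ} → _≈_ {σ} ; apply = λ f x → proj₁ f x ; ⟦_⟧ = ⟦_⟧ }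

data CBool : Set where
  c⊥ ctt cff : CBool

data _⊑C_ : CBool → CBool → Set where
  ⊥⊑    : ∀ {x} → c⊥ ⊑C x
  ⊑C-rf : ∀ {x} → x ⊑C x

⊑C-trans : ∀ {x y z} → x ⊑C y → y ⊑C z → x ⊑C z
⊑C-trans ⊥⊑    _ = ⊥⊑
⊑C-trans ⊑C-rf q = q

module 𝒞M = MonotoneFrame CBool _⊑C_ (λ _ → ⊑C-rf) ⊑C-trans

𝒞 : Frame
𝒞 = 𝒞M.frame

data EBool : Set where
  ett eff e⊤ : EBool

data _⊑E_ : EBool → EBool → Set where
  ⊑⊤    : ∀ {x} → x ⊑E e⊤
  ⊑E-rf : ∀ {x} → x ⊑E x

⊑E-trans : ∀ {x y z} → x ⊑E y → y ⊑E z → x ⊑E z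
⊑E-trans p     ⊑⊤    = ⊑⊤
⊑E-trans p     ⊑E-rf = p

module ℰM = MonotoneFrame EBool _⊑E_ (λ _ → ⊑E-rf) ⊑E-trans

ℰ : Frame
ℰ = ℰM.frame

data Ebool : CBool → EBool → Set where
  tt-tt : Ebool ctt ett
  ff-ff : Ebool cff eff
  ⊥-⊤   : Ebool c⊥ e⊤

E : ∀ σ → Frame.Car 𝒞 σ → Frame.Car ℰ σ → Set
E bool    x y = Ebool x y
E (σ ⇒ τ) f g = ∀ x y → E σ x y → E τ (proj₁ f x) (proj₁ g y)

Rel : Frame → Frame → Set₁
Rel M N = ∀ σ → Frame.Car M σ → Frame.Car N σ → Set

record PreLogical (M N : Frame) (R : Rel M N) : Set where
  private
    module M = Frame M
    module N = Frame N
  field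
    app-closed : ∀ {σ τ} (f : M.Car (σ ⇒ τ)) (g : N.Car (σ ⇒ τ))
                   (x : M.Car σ) (y : N.Car σ) →
                 R (σ ⇒ τ) f g → R σ x y → R τ (M.apply f x) (N.apply g y)
    lam-closed : ∀ {Γ σ τ} (P : Tm (Γ ▸ σ) τ) (ρ : Env M.Car Γ) (ρ' : Env N.Car Γ) →
                 (∀ {υ} (x : Γ ∋ υ) → R υ (ρ x) (ρ' x)) →
                 (∀ a b → R σ a b → R τ (M.⟦ P ⟧ (ρ ,, a)) (N.⟦ P ⟧ (ρ' ,, b))) →
                 R (σ ⇒ τ) (M.⟦ lam P ⟧ ρ) (N.⟦ lam P ⟧ ρ')

record PreLogicalSurjection (M N : Frame) (R : Rel M N) : Set where
  private
    module M = Frame M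
    module N = Frame N
  field
    preLogical  : PreLogical M N R
    surjective  : ∀ σ (b : N.Car σ) → Σ (M.Car σ) (λ a → R σ a b)
    partialFun  : ∀ σ (a : M.Car σ) (b b' : N.Car σ) →
                  R σ a b → R σ a b' → N._≈_ b b'

inverse : ∀ {M N} → Rel M N → Rel N M
inverse R σ b a = R σ a b

PreLogicalIso : (M N : Frame) → Rel M N → Set
PreLogicalIso M N R = PreLogicalSurjection M N R × PreLogicalSurjection N M (inverse {M} {N} R)

module Submission where

-- Exchanging ⊥ and ⊤ is an order-reversing bijection φ : 𝒞_bool → ℰ_bool with inverse ψ.
-- It lifts to every type by φ f = φ ∘ f ∘ ψ and ψ g = ψ ∘ g ∘ φ, which are again monotone
-- because they conjugate by two antitone maps. By induction on types, E is, up to extensional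
-- equality, both the graph of φ and the converse of the graph of ψ, so E and E⁻¹ are surjective
-- and functional. Both are logical relations, hence pre-logical: in monotone frames application
-- of a λ-abstraction is β-reduced definitionally.

open import Defs
open import Data.Product using (_,_; proj₁; proj₂)
open import Relation.Binary.PropositionalEquality using (_≡_; refl; sym; trans)

module MonotoneFrameProperties
  (B : Set) (_⊑_ : B → B → Set)
  (⊑-refl : ∀ x → x ⊑ x)
  (⊑-trans : ∀ {x y z} → x ⊑ y → y ⊑ z → x ⊑ z)
  (⊑-antisym : ∀ {x y} → x ⊑ y → y ⊑ x → x ≡ y) where

  open MonotoneFrame B _⊑_ ⊑-refl ⊑-trans

  ≈-sym : ∀ σ {x y : Car σ} → _≈_ {σ} x y → _≈_ {σ} y x
  ≈-sym bool    x≈y = sym x≈y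
  ≈-sym (σ ⇒ τ) f≈g = λ x → ≈-sym τ (f≈g x)

  ≈-trans : ∀ σ {x y z : Car σ} → _≈_ {σ} x y → _≈_ {σ} y z → _≈_ {σ} x z
  ≈-trans bool    x≈y y≈z = trans x≈y y≈z
  ≈-trans (σ ⇒ τ) f≈g g≈h = λ x → ≈-trans τ (f≈g x) (g≈h x)

  ≈⇒≤ : ∀ σ {x y : Car σ} → _≈_ {σ} x y → _≤_ {σ} x y
  ≈⇒≤ bool    {x} refl = ⊑-refl x
  ≈⇒≤ (σ ⇒ τ) f≈g      = λ x → ≈⇒≤ τ (f≈g x)

  ≤-antisym : ∀ σ {x y : Car σ} → _≤_ {σ} x y → _≤_ {σ} y x → _≈_ {σ} x y
  ≤-antisym bool    x≤y y≤x = ⊑-antisym x≤y y≤x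
  ≤-antisym (σ ⇒ τ) f≤g g≤f = λ x → ≤-antisym τ (f≤g x) (g≤f x)

  monotone-resp-≈ : ∀ σ τ (f : Car (σ ⇒ τ)) {x y : Car σ} →
                    _≈_ {σ} x y → _≈_ {τ} (proj₁ f x) (proj₁ f y)
  monotone-resp-≈ σ τ (_ , f-mono) x≈y =
    ≤-antisym τ (f-mono (≈⇒≤ σ x≈y)) (f-mono (≈⇒≤ σ (≈-sym σ x≈y)))

⊑C-antisym : ∀ {x y} → x ⊑C y → y ⊑C x → x ≡ y
⊑C-antisym ⊥⊑    ⊥⊑    = refl
⊑C-antisym ⊥⊑    ⊑C-rf = refl
⊑C-antisym ⊑C-rf _     = refl

⊑E-antisym : ∀ {x y} → x ⊑E y → y ⊑E x → x ≡ y
⊑E-antisym ⊑⊤    ⊑⊤    = refl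
⊑E-antisym ⊑⊤    ⊑E-rf = refl
⊑E-antisym ⊑E-rf _     = refl

module 𝒞P = MonotoneFrameProperties CBool _⊑C_ (λ _ → ⊑C-rf) ⊑C-trans ⊑C-antisym
module ℰP = MonotoneFrameProperties EBool _⊑E_ (λ _ → ⊑E-rf) ⊑E-trans ⊑E-antisym

open 𝒞M using () renaming (Car to 𝒞Car; _≤_ to _≤C_; _≈_ to _≈C_)
open ℰM using () renaming (Car to ℰCar; _≤_ to _≤E_; _≈_ to _≈E_)

mutual
  φ : ∀ σ → 𝒞Car σ → ℰCar σ
  φ bool    c⊥  = e⊤
  φ bool    ctt = ett
  φ bool    cff = eff
  φ (σ ⇒ τ) f   = (λ y → φ τ (proj₁ f (ψ σ y))) ,
                  (λ y≤y' → φ-antitone τ (proj₂ f (ψ-antitone σ y≤y')))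

  ψ : ∀ σ → ℰCar σ → 𝒞Car σ
  ψ bool    ett = ctt
  ψ bool    eff = cff
  ψ bool    e⊤  = c⊥
  ψ (σ ⇒ τ) g   = (λ x → ψ τ (proj₁ g (φ σ x))) ,
                  (λ x≤x' → ψ-antitone τ (proj₂ g (φ-antitone σ x≤x')))

  φ-antitone : ∀ σ {x x' : 𝒞Car σ} → _≤C_ {σ} x x' → _≤E_ {σ} (φ σ x') (φ σ x)
  φ-antitone bool    ⊥⊑     = ⊑⊤
  φ-antitone bool    ⊑C-rf  = ⊑E-rf
  φ-antitone (σ ⇒ τ) f≤f'   = λ y → φ-antitone τ (f≤f' (ψ σ y))

  ψ-antitone : ∀ σ {y y' : ℰCar σ} → _≤E_ {σ} y y' → _≤C_ {σ} (ψ σ y') (ψ σ y)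
  ψ-antitone bool    {ett} ⊑⊤    = ⊥⊑
  ψ-antitone bool    {eff} ⊑⊤    = ⊥⊑
  ψ-antitone bool    {e⊤}  ⊑⊤    = ⊑C-rf
  ψ-antitone bool          ⊑E-rf = ⊑C-rf
  ψ-antitone (σ ⇒ τ)       g≤g'  = λ x → ψ-antitone τ (g≤g' (φ σ x))

φ-resp-≈ : ∀ σ {x x' : 𝒞Car σ} → _≈C_ {σ} x x' → _≈E_ {σ} (φ σ x) (φ σ x')
φ-resp-≈ σ x≈x' =
  ℰP.≤-antisym σ (φ-antitone σ (𝒞P.≈⇒≤ σ (𝒞P.≈-sym σ x≈x'))) (φ-antitone σ (𝒞P.≈⇒≤ σ x≈x'))

ψ-resp-≈ : ∀ σ {y y' : ℰCar σ} → _≈E_ {σ} y y' → _≈C_ {σ} (ψ σ y) (ψ σ y')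
ψ-resp-≈ σ y≈y' =
  𝒞P.≤-antisym σ (ψ-antitone σ (ℰP.≈⇒≤ σ (ℰP.≈-sym σ y≈y'))) (ψ-antitone σ (ℰP.≈⇒≤ σ y≈y'))

E-respʳ-≈ : ∀ σ {x y y'} → E σ x y → _≈E_ {σ} y y' → E σ x y'
E-respʳ-≈ bool    xEy  refl = xEy
E-respʳ-≈ (σ ⇒ τ) fEg  g≈g' = λ a b aEb → E-respʳ-≈ τ (fEg a b aEb) (g≈g' b)

E-respˡ-≈ : ∀ σ {x x' y} → E σ x y → _≈C_ {σ} x x' → E σ x' y
E-respˡ-≈ bool    xEy  refl = xEy
E-respˡ-≈ (σ ⇒ τ) fEg  f≈f' = λ a b aEb → E-respˡ-≈ τ (fEg a b aEb) (f≈f' a)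

mutual
  E-φ : ∀ σ (x : 𝒞Car σ) → E σ x (φ σ x)
  E-φ bool    c⊥  = ⊥-⊤
  E-φ bool    ctt = tt-tt
  E-φ bool    cff = ff-ff
  E-φ (σ ⇒ τ) f a b aEb =
    E-respʳ-≈ τ (E-φ τ (proj₁ f a)) (φ-resp-≈ τ (𝒞P.monotone-resp-≈ σ τ f (E⇒≈ψ σ aEb)))

  E-ψ : ∀ σ (y : ℰCar σ) → E σ (ψ σ y) y
  E-ψ bool    ett = tt-tt
  E-ψ bool    eff = ff-ff
  E-ψ bool    e⊤  = ⊥-⊤
  E-ψ (σ ⇒ τ) g a b aEb =
    E-respˡ-≈ τ (E-ψ τ (proj₁ g b)) (ψ-resp-≈ τ (ℰP.monotone-resp-≈ σ τ g (E⇒≈φ σ aEb)))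

  E⇒≈φ : ∀ σ {x y} → E σ x y → _≈E_ {σ} y (φ σ x)
  E⇒≈φ bool    tt-tt = refl
  E⇒≈φ bool    ff-ff = refl
  E⇒≈φ bool    ⊥-⊤   = refl
  E⇒≈φ (σ ⇒ τ) fEg   = λ y → E⇒≈φ τ (fEg (ψ σ y) y (E-ψ σ y))

  E⇒≈ψ : ∀ σ {x y} → E σ x y → _≈C_ {σ} x (ψ σ y)
  E⇒≈ψ bool    tt-tt = refl
  E⇒≈ψ bool    ff-ff = refl
  E⇒≈ψ bool    ⊥-⊤   = refl
  E⇒≈ψ (σ ⇒ τ) fEg   = λ x → E⇒≈ψ τ (fEg x (φ σ x) (E-φ σ x))

E-preLogical : PreLogical 𝒞 ℰ E
E-preLogical = record
  { app-closed = λ f g x y fEg xEy → fEg x y xEy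
  ; lam-closed = λ P ρ ρ' _ body → body
  }

E⁻¹-preLogical : PreLogical ℰ 𝒞 (inverse {𝒞} {ℰ} E)
E⁻¹-preLogical = record
  { app-closed = λ g f y x fEg xEy → fEg x y xEy
  ; lam-closed = λ P ρ' ρ _ body → λ a b aEb → body b a aEb
  }

E-surjection : PreLogicalSurjection 𝒞 ℰ E
E-surjection = record
  { preLogical = E-preLogical
  ; surjective = λ σ y → ψ σ y , E-ψ σ y
  ; partialFun = λ σ x y y' xEy xEy' →
      ℰP.≈-trans σ (E⇒≈φ σ xEy) (ℰP.≈-sym σ (E⇒≈φ σ xEy'))
  }

E⁻¹-surjection : PreLogicalSurjection ℰ 𝒞 (inverse {𝒞} {ℰ} E)
E⁻¹-surjection = record
  { preLogical = E⁻¹-preLogical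
  ; surjective = λ σ x → φ σ x , E-φ σ x
  ; partialFun = λ σ y x x' xEy x'Ey →
      𝒞P.≈-trans σ (E⇒≈ψ σ xEy) (𝒞P.≈-sym σ (E⇒≈ψ σ x'Ey))
  }

proposition3p9 : PreLogicalIso 𝒞 ℰ E
proposition3p9 = E-surjection , E⁻¹-surjection
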